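{- Let $P\subset\mathbb{R}^d$ be a $\pm1$-polytope and let $v,w$ be two distinct vertices of $P$. Then $\{v,w\}$ is an edge of $P$ if and only if $\operatorname{conv}\{v,w\}\cap\operatorname{conv}\big(P\cap \mathcal{Q}^*(v,w)\big)=\varnothing$.
   Context: A $\pm1$-polytope is the convex hull of a subset of $\{ -1,+1\}^d$. For $v,w\in\{ -1,+1\}^d$, $\mathcal{Q}(v,w)$ denotes the set of all points of $\{ -1,+1\}^d$ that agree with $v$ and $w$ in every coordinate in which $v$ and $w$ agree, and $\mathcal{Q}^*(v,w):=\mathcal{Q}(v,w)\setminus\{v,w\}$. An edge of $P$ is a one-dimensional face, identified with its pair of endpoints.
   Formalization: The coefficients of supporting hyperplanes, the points of $\operatorname{conv}\{v,w\}$ and all convex weights are taken in ℚ instead of ℝ. -}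

module Defs where

open import Data.Nat using (ℕ)
open import Data.Bool using (Bool; true; false)
open import Data.Rational using (ℚ; 0ℚ; 1ℚ; -_; _+_; _*_; _≤_; _<_)
open import Data.Vec using (Vec; []; _∷_; zipWith; foldr; replicate; lookup)
open import Data.Fin using (Fin)
open import Data.List using (List; map)
open import Data.List.Relation.Unary.All using (All)
open import Data.List.Membership.Propositional using (_∈_)
open import Data.Product using (Σ; ∃; _×_; _,_; proj₁; proj₂)
open import Data.Sum using (_⊎_)
open import Relation.Binary.PropositionalEquality using (_≡_; _≢_)
open import Relation.Nullary using (¬_)

-- A point of {-1,+1}^d, encoded as a vector of Booleans (true ↦ +1, false ↦ -1).
Cube : ℕ → Set
Cube d = Vec Bool d

sgn : Bool → ℚ
sgn true  = 1ℚ
sgn false = - 1ℚ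

embed : ∀ {d} → Cube d → Vec ℚ d
embed = Data.Vec.map sgn

_·_ : ∀ {d} → Vec ℚ d → Vec ℚ d → ℚ
x · y = foldr _ _+_ 0ℚ (zipWith _*_ x y)

_⊛_ : ∀ {d} → ℚ → Vec ℚ d → Vec ℚ d
a ⊛ x = Data.Vec.map (a *_) x

_⊕_ : ∀ {d} → Vec ℚ d → Vec ℚ d → Vec ℚ d
_⊕_ = zipWith _+_

InQ : ∀ {d} → Cube d → Cube d → Cube d → Set
InQ v w u = ∀ i → lookup v i ≡ lookup w i → lookup u i ≡ lookup v i

InQ* : ∀ {d} → Cube d → Cube d → Cube d → Set
InQ* v w u = InQ v w u × u ≢ v × u ≢ w

InConv : ∀ {d} → (Cube d → Set) → Vec ℚ d → Set
InConv {d} T x =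
  Σ (List (ℚ × Cube d)) λ cs →
      All (λ p → 0ℚ ≤ proj₁ p × T (proj₂ p)) cs
    × Data.List.foldr (λ p acc → proj₁ p + acc) 0ℚ cs ≡ 1ℚ
    × Data.List.foldr (λ p acc → (proj₁ p ⊛ embed (proj₂ p)) ⊕ acc) (replicate _ 0ℚ) cs ≡ x

-- The ±1-polytope P = conv(S) for a finite S ⊆ {-1,+1}^d (given as a list).
-- Every point of S is a vertex of P, and P ∩ {-1,+1}^d = S.

IsEdge : ∀ {d} → List (Cube d) → Cube d → Cube d → Set
IsEdge {d} S v w =
  Σ (Vec ℚ d) λ c → Σ ℚ λ b →
      c · embed v ≡ b
    × c · embed w ≡ b
    × (∀ u → u ∈ S → c · embed u ≤ b)
    × (∀ u → u ∈ S → c · embed u ≡ b → u ≡ v ⊎ u ≡ w)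

SegmentAvoids : ∀ {d} → List (Cube d) → Cube d → Cube d → Set
SegmentAvoids {d} S v w =
  ¬ (Σ ℚ λ t → 0ℚ ≤ t × t ≤ 1ℚ ×
       InConv (λ u → u ∈ S × InQ* v w u)
              ((t ⊛ embed v) ⊕ ((1ℚ + (- t)) ⊛ embed w)))

{-# OPTIONS --safe #-}
module Submission where

-- If c·x ≤ b cuts out the edge {v,w}, every point of P ∩ Q*(v,w) lies strictly
-- below the hyperplane c·x = b, which contains conv{v,w}; so the two hulls are
-- disjoint.  Conversely, suppose they are disjoint and apply Gordan's alternative
-- (a consequence of Fourier–Motzkin elimination) to the vectors u − v and u − w,
-- u ∈ P ∩ Q*(v,w).  A nonnegative dependence among them would exhibit a point of
-- conv{v,w} in conv(P ∩ Q*), so there is a functional c with c·u < c·v, c·w on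
-- P ∩ Q*.  Adding a multiple of ½(v − w) makes c·v = c·w, and adding a large
-- multiple of ½(v + w), which on the cube is maximal exactly on Q(v,w), pushes
-- every other vertex of P strictly below.

open import Level using (0ℓ)
open import Function using (_∘_; id)
open import Data.Bool as Bool using (Bool; true; false)
open import Data.Empty using (⊥-elim)
open import Data.Fin using (zero; suc)
open import Data.Fin.Properties using (all?)
open import Data.List using (List; []; _∷_; _++_; map; foldr; concat; filter; cartesianProduct)
open import Data.List.Properties using (foldr-map)
open import Data.List.Membership.Propositional using (_∈_; find; lose)
open import Data.List.Membership.Propositional.Properties
  using (∈-filter⁺; ∈-filter⁻; ∈-map⁺; ∈-map⁻; ∈-++⁺ˡ; ∈-++⁺ʳ; ∈-++⁻;
         ∈-cartesianProduct⁺; ∈-cartesianProduct⁻)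
open import Data.List.Relation.Unary.All as All using (All; []; _∷_)
import Data.List.Relation.Unary.All.Properties as All
open import Data.List.Relation.Unary.Any as Any using (Any; here; there)
import Data.List.Relation.Unary.Any.Properties as Any
open import Data.Nat using (ℕ; zero; suc)
open import Data.Product using (Σ; ∃-syntax; _×_; _,_; proj₁; proj₂; map₁; map₂)
open import Data.Rational using (ℚ; 0ℚ; 1ℚ; ½; -_; _+_; _*_; _-_; _≤_; _<_; 1/_; ≢-nonZero; positive; nonNegative)
open import Data.Rational.Properties
open import Data.Sum using (_⊎_; inj₁; inj₂; [_,_]′)
open import Data.Vec using (Vec; []; _∷_; zipWith; replicate; head; tail; lookup)
open import Data.Vec.Properties
  using (zipWith-assoc; zipWith-identityˡ; map-cong; map-∘; map-replicate; ≡-dec)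
open import Relation.Binary.Bundles using (DecTotalOrder)
open import Relation.Binary.Definitions using (Tri; tri<; tri≈; tri>)
open import Relation.Binary.PropositionalEquality
open import Relation.Nullary using (Dec; yes; no)
open import Relation.Nullary.Decidable using (dec⇒maybe; _→-dec_; _×-dec_; ¬?)
open import Relation.Unary using (Decidable)
open import Tactic.RingSolver using (solve-∀)
open import Tactic.RingSolver.Core.AlmostCommutativeRing using (AlmostCommutativeRing; fromCommutativeRing)

open import Data.List.Extrema (DecTotalOrder.totalOrder ≤-decTotalOrder)
  using (max; min; xs≤max; ⊥≤max; min≤xs; argmax-all; argmin-all)

open import Defs

private
  variable
    n : ℕ
    A I : Set

ℚ-ring : AlmostCommutativeRing 0ℓ 0ℓ
ℚ-ring = fromCommutativeRing +-*-commutativeRing (λ x → dec⇒maybe (0ℚ ≟ x))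

0<1 : 0ℚ < 1ℚ
0<1 = positive⁻¹ 1ℚ

p<q⇒0<q-p : ∀ {p q} → p < q → 0ℚ < q - p
p<q⇒0<q-p {p} {q} p<q = subst (_< q - p) (+-inverseʳ p) (+-monoˡ-< (- p) p<q)

p≤q⇒0≤q-p : ∀ {p q} → p ≤ q → 0ℚ ≤ q - p
p≤q⇒0≤q-p {p} {q} p≤q = subst (_≤ q - p) (+-inverseʳ p) (+-monoˡ-≤ (- p) p≤q)

p-q+q≡p : ∀ p q → p - q + q ≡ p
p-q+q≡p = solve-∀ ℚ-ring

0<q-p⇒p<q : ∀ {p q} → 0ℚ < q - p → p < q
0<q-p⇒p<q {p} {q} 0<q-p = subst₂ _<_ (+-identityˡ p) (p-q+q≡p q p) (+-monoˡ-< p 0<q-p)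

0≤q-p⇒p≤q : ∀ {p q} → 0ℚ ≤ q - p → p ≤ q
0≤q-p⇒p≤q {p} {q} 0≤q-p = subst₂ _≤_ (+-identityˡ p) (p-q+q≡p q p) (+-monoˡ-≤ p 0≤q-p)

p-q<0⇒p<q : ∀ {p q} → p - q < 0ℚ → p < q
p-q<0⇒p<q {p} {q} p-q<0 = subst₂ _<_ (p-q+q≡p p q) (+-identityˡ q) (+-monoˡ-< q p-q<0)

p<-q⇒p+q<0 : ∀ {p q} → p < - q → p + q < 0ℚ
p<-q⇒p+q<0 {p} {q} p<-q = subst (p + q <_) (+-inverseˡ q) (+-monoˡ-< q p<-q)

p+q<0⇒q<-p : ∀ {p q} → p + q < 0ℚ → q < - p
p+q<0⇒q<-p {p} {q} p+q<0 = subst₂ _<_ (p+q-p≡q p q) (+-identityˡ (- p)) (+-monoˡ-< (- p) p+q<0)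
  where
  p+q-p≡q : ∀ p q → p + q - p ≡ q
  p+q-p≡q = solve-∀ ℚ-ring

p<p+1 : ∀ p → p < p + 1ℚ
p<p+1 p = subst (_< p + 1ℚ) (+-identityʳ p) (+-monoʳ-< p 0<1)

p-1<p : ∀ p → p - 1ℚ < p
p-1<p p = subst (p - 1ℚ <_) (p-q+q≡p p 1ℚ) (p<p+1 (p - 1ℚ))

≤∧≢⇒< : ∀ {p q} → p ≤ q → p ≢ q → p < q
≤∧≢⇒< {p} {q} p≤q p≢q with <-cmp p q
... | tri< p<q _ _ = p<q
... | tri≈ _ p≡q _ = ⊥-elim (p≢q p≡q)
... | tri> _ _ p>q = ⊥-elim (<-irrefl refl (<-≤-trans p>q p≤q))

*-pos : ∀ {p q} → 0ℚ < p → 0ℚ < q → 0ℚ < p * q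
*-pos {p} {q} 0<p 0<q = positive⁻¹ (p * q) {{pos*pos⇒pos p {{positive 0<p}} q {{positive 0<q}}}}

*-nonNeg : ∀ {p q} → 0ℚ ≤ p → 0ℚ ≤ q → 0ℚ ≤ p * q
*-nonNeg {p} {q} 0≤p 0≤q =
  nonNegative⁻¹ (p * q) {{nonNeg*nonNeg⇒nonNeg p {{nonNegative 0≤p}} q {{nonNegative 0≤q}}}}

-- A total reciprocal; its value at 0 is never used.
inv : ℚ → ℚ
inv p with p ≟ 0ℚ
... | yes _   = 0ℚ
... | no p≢0 = (1/ p) {{≢-nonZero p≢0}}

*-inv : ∀ {p} → p ≢ 0ℚ → p * inv p ≡ 1ℚ
*-inv {p} p≢0 with p ≟ 0ℚ
... | yes p≡0  = ⊥-elim (p≢0 p≡0)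
... | no p≢0′ = *-inverseʳ p {{≢-nonZero p≢0′}}

inv-pos : ∀ {p} → 0ℚ < p → 0ℚ < inv p
inv-pos {p} 0<p with p ≟ 0ℚ
... | yes p≡0 = ⊥-elim (<⇒≢ 0<p (sym p≡0))
... | no p≢0  = positive⁻¹ _ {{1/pos⇒pos p {{positive 0<p}}}}

0<p⇒p≢0 : ∀ {p} → 0ℚ < p → p ≢ 0ℚ
0<p⇒p≢0 0<p = <⇒≢ 0<p ∘ sym

separating-point : ∀ (L U : List ℚ) → All (λ l → All (l <_) U) L →
  ∃[ x ] All (_< x) L × All (x <_) U
separating-point L U L<U = x , All.tabulate l<x , All.tabulate x<u
  where
  m₀ m M : ℚ
  m₀ = min 0ℚ U - 1ℚ
  m  = max m₀ L
  M  = min (m + 1ℚ) U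

  m₀<u : ∀ {u} → u ∈ U → m₀ < u
  m₀<u u∈U = <-≤-trans (p-1<p (min 0ℚ U)) (All.lookup (min≤xs 0ℚ U) u∈U)

  m<u : ∀ {u} → u ∈ U → m < u
  m<u u∈U = argmax-all id (m₀<u u∈U) (All.map (λ l<U → All.lookup l<U u∈U) L<U)

  m<M : m < M
  m<M = argmin-all id (p<p+1 m) (All.tabulate m<u)

  x : ℚ
  x = proj₁ (<-dense m<M)

  l<x : ∀ {l} → l ∈ L → l < x
  l<x l∈L = ≤-<-trans (All.lookup (xs≤max m₀ L) l∈L) (proj₁ (proj₂ (<-dense m<M)))

  x<u : ∀ {u} → u ∈ U → x < u
  x<u u∈U = <-≤-trans (proj₂ (proj₂ (<-dense m<M))) (All.lookup (min≤xs (m + 1ℚ) U) u∈U)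

∑ : (A → ℚ) → List A → ℚ
∑ g = foldr (λ x acc → g x + acc) 0ℚ

∑-cong : ∀ {g h : A → ℚ} → (∀ x → g x ≡ h x) → ∀ xs → ∑ g xs ≡ ∑ h xs
∑-cong g≗h []       = refl
∑-cong g≗h (x ∷ xs) = cong₂ _+_ (g≗h x) (∑-cong g≗h xs)

∑-+ : ∀ (g h : A → ℚ) xs → ∑ (λ x → g x + h x) xs ≡ ∑ g xs + ∑ h xs
∑-+ g h []       = refl
∑-+ g h (x ∷ xs) = trans (cong (g x + h x +_) (∑-+ g h xs)) (interchange (g x) (h x) (∑ g xs) (∑ h xs))
  where
  interchange : ∀ a b c d → a + b + (c + d) ≡ a + c + (b + d)
  interchange = solve-∀ ℚ-ring

∑-*ˡ : ∀ (g : A → ℚ) k xs → ∑ (λ x → k * g x) xs ≡ k * ∑ g xs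
∑-*ˡ g k []       = sym (*-zeroʳ k)
∑-*ˡ g k (x ∷ xs) = trans (cong (k * g x +_) (∑-*ˡ g k xs)) (sym (*-distribˡ-+ k (g x) (∑ g xs)))

∑-nonNeg : ∀ {g : A → ℚ} {xs} → All (λ x → 0ℚ ≤ g x) xs → 0ℚ ≤ ∑ g xs
∑-nonNeg []         = ≤-refl
∑-nonNeg (0≤gx ∷ h) = +-mono-≤ 0≤gx (∑-nonNeg h)

∑-pos : ∀ {g : A → ℚ} {xs} → All (λ x → 0ℚ ≤ g x) xs → Any (λ x → 0ℚ < g x) xs → 0ℚ < ∑ g xs
∑-pos (_ ∷ h)    (here 0<gx) = +-mono-<-≤ 0<gx (∑-nonNeg h)
∑-pos (0≤gx ∷ h) (there any) = +-mono-≤-< 0≤gx (∑-pos h any)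

module _ {μ g : A → ℚ} {b : ℚ} where

  ∑-weighted-≤ : ∀ {xs} → All (λ x → 0ℚ ≤ μ x × g x ≤ b) xs →
    ∑ (λ x → μ x * g x) xs ≤ ∑ μ xs * b
  ∑-weighted-≤ [] = ≤-reflexive (sym (*-zeroˡ b))
  ∑-weighted-≤ {x ∷ xs} ((0≤μx , gx≤b) ∷ h) =
    ≤-trans (+-mono-≤ (*-monoˡ-≤-nonNeg (μ x) {{nonNegative 0≤μx}} gx≤b) (∑-weighted-≤ h))
            (≤-reflexive (sym (*-distribʳ-+ b (μ x) (∑ μ xs))))

  ∑-weighted-< : ∀ {xs} → All (λ x → 0ℚ ≤ μ x × g x < b) xs → 0ℚ < ∑ μ xs →
    ∑ (λ x → μ x * g x) xs < ∑ μ xs * b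
  ∑-weighted-< [] 0<0 = ⊥-elim (<-irrefl refl 0<0)
  ∑-weighted-< {x ∷ xs} ((0≤μx , gx<b) ∷ h) 0<∑ with 0ℚ <? μ x
  ... | yes 0<μx = <-≤-trans
    (+-mono-<-≤ (*-monoʳ-<-pos (μ x) {{positive 0<μx}} gx<b) (∑-weighted-≤ (All.map (map₂ <⇒≤) h)))
    (≤-reflexive (sym (*-distribʳ-+ b (μ x) (∑ μ xs))))
  ... | no 0≮μx = <-≤-trans
    (+-mono-≤-< (*-monoˡ-≤-nonNeg (μ x) {{nonNegative 0≤μx}} (<⇒≤ gx<b)) (∑-weighted-< h 0<∑μxs))
    (≤-reflexive (sym (*-distribʳ-+ b (μ x) (∑ μ xs))))
    where
    0<∑μxs : 0ℚ < ∑ μ xs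
    0<∑μxs = <-≤-trans 0<∑
      (subst (μ x + ∑ μ xs ≤_) (+-identityˡ (∑ μ xs)) (+-monoˡ-≤ (∑ μ xs) (≮⇒≥ 0≮μx)))

0ᵛ : Vec ℚ n
0ᵛ = replicate _ 0ℚ

_⊖_ : Vec ℚ n → Vec ℚ n → Vec ℚ n
x ⊖ y = x ⊕ ((- 1ℚ) ⊛ y)

⊕-identityˡ : (x : Vec ℚ n) → 0ᵛ ⊕ x ≡ x
⊕-identityˡ = zipWith-identityˡ +-identityˡ

⊕-assoc : (x y z : Vec ℚ n) → (x ⊕ y) ⊕ z ≡ x ⊕ (y ⊕ z)
⊕-assoc = zipWith-assoc +-assoc

⊛-distrib-⊕ : ∀ k (x y : Vec ℚ n) → k ⊛ (x ⊕ y) ≡ (k ⊛ x) ⊕ (k ⊛ y)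
⊛-distrib-⊕ k []      []      = refl
⊛-distrib-⊕ k (a ∷ x) (b ∷ y) = cong₂ _∷_ (*-distribˡ-+ k a b) (⊛-distrib-⊕ k x y)

*-⊛ : ∀ k l (x : Vec ℚ n) → (k * l) ⊛ x ≡ k ⊛ (l ⊛ x)
*-⊛ k l x = trans (map-cong (*-assoc k l) x) (map-∘ (k *_) (l *_) x)

⊛-0ᵛ : ∀ k → k ⊛ 0ᵛ {n} ≡ 0ᵛ
⊛-0ᵛ {n} k = trans (map-replicate (k *_) 0ℚ n) (cong (replicate n) (*-zeroʳ k))

⊖≡0ᵛ⇒≡ : (x y : Vec ℚ n) → x ⊖ y ≡ 0ᵛ → x ≡ y
⊖≡0ᵛ⇒≡ []      []      _ = refl
⊖≡0ᵛ⇒≡ (a ∷ x) (b ∷ y) e = cong₂ _∷_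
  (a-b≡0⇒a≡b a b (cong head e)) (⊖≡0ᵛ⇒≡ x y (cong tail e))
  where
  a-b≡0⇒a≡b : ∀ a b → a + (- 1ℚ) * b ≡ 0ℚ → a ≡ b
  a-b≡0⇒a≡b a b e = trans (a≡[a-b]+b a b) (trans (cong (_+ b) e) (+-identityˡ b))
    where
    a≡[a-b]+b : ∀ a b → a ≡ a + (- 1ℚ) * b + b
    a≡[a-b]+b = solve-∀ ℚ-ring

·-comm : (x y : Vec ℚ n) → x · y ≡ y · x
·-comm []      []      = refl
·-comm (a ∷ x) (b ∷ y) = cong₂ _+_ (*-comm a b) (·-comm x y)

·-0ᵛ : (c : Vec ℚ n) → c · 0ᵛ ≡ 0ℚ
·-0ᵛ []      = refl
·-0ᵛ (γ ∷ c) = trans (cong (γ * 0ℚ +_) (·-0ᵛ c)) (trans (+-identityʳ _) (*-zeroʳ γ))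

·-⊕ʳ : (c x y : Vec ℚ n) → c · (x ⊕ y) ≡ c · x + c · y
·-⊕ʳ []      []      []      = refl
·-⊕ʳ (γ ∷ c) (a ∷ x) (b ∷ y) = trans (cong (γ * (a + b) +_) (·-⊕ʳ c x y)) (distrib γ a b (c · x) (c · y))
  where
  distrib : ∀ γ a b X Y → γ * (a + b) + (X + Y) ≡ γ * a + X + (γ * b + Y)
  distrib = solve-∀ ℚ-ring

·-⊛ʳ : (c : Vec ℚ n) (k : ℚ) (x : Vec ℚ n) → c · (k ⊛ x) ≡ k * (c · x)
·-⊛ʳ []      k []      = sym (*-zeroʳ k)
·-⊛ʳ (γ ∷ c) k (a ∷ x) = trans (cong (γ * (k * a) +_) (·-⊛ʳ c k x)) (pull γ k a (c · x))
  where
  pull : ∀ γ k a X → γ * (k * a) + k * X ≡ k * (γ * a + X)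
  pull = solve-∀ ℚ-ring

·-⊖ʳ : (c x y : Vec ℚ n) → c · (x ⊖ y) ≡ c · x - c · y
·-⊖ʳ c x y = trans (·-⊕ʳ c x _) (cong (c · x +_) (trans (·-⊛ʳ c (- 1ℚ) y) (-1*p≡-p (c · y))))
  where
  -1*p≡-p : ∀ p → (- 1ℚ) * p ≡ - p
  -1*p≡-p = solve-∀ ℚ-ring

·-∷ : ∀ c₀ (c : Vec ℚ n) x → (c₀ ∷ c) · x ≡ c₀ * head x + c · tail x
·-∷ c₀ c (_ ∷ _) = refl

·-⊕ˡ : (x y c : Vec ℚ n) → (x ⊕ y) · c ≡ x · c + y · c
·-⊕ˡ x y c = trans (·-comm (x ⊕ y) c) (trans (·-⊕ʳ c x y) (cong₂ _+_ (·-comm c x) (·-comm c y)))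

·-⊛ˡ : (k : ℚ) (x c : Vec ℚ n) → (k ⊛ x) · c ≡ k * (x · c)
·-⊛ˡ k x c = trans (·-comm (k ⊛ x) c) (trans (·-⊛ʳ c k x) (cong (k *_) (·-comm c x)))

lincomb : (I → Vec ℚ n) → List (ℚ × I) → Vec ℚ n
lincomb f = foldr (λ p acc → (proj₁ p ⊛ f (proj₂ p)) ⊕ acc) 0ᵛ

lincomb-++ : ∀ (f : I → Vec ℚ n) cs ds → lincomb f (cs ++ ds) ≡ lincomb f cs ⊕ lincomb f ds
lincomb-++ f []             ds = sym (⊕-identityˡ (lincomb f ds))
lincomb-++ f ((μ , i) ∷ cs) ds =
  trans (cong ((μ ⊛ f i) ⊕_) (lincomb-++ f cs ds)) (sym (⊕-assoc (μ ⊛ f i) (lincomb f cs) (lincomb f ds)))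

lincomb-scale : ∀ (f : I → Vec ℚ n) k cs → lincomb f (map (map₁ (k *_)) cs) ≡ k ⊛ lincomb f cs
lincomb-scale f k []             = sym (⊛-0ᵛ k)
lincomb-scale f k ((μ , i) ∷ cs) = begin
  ((k * μ) ⊛ f i) ⊕ lincomb f (map (map₁ (k *_)) cs) ≡⟨ cong₂ _⊕_ (*-⊛ k μ (f i)) (lincomb-scale f k cs) ⟩
  (k ⊛ (μ ⊛ f i)) ⊕ (k ⊛ lincomb f cs)               ≡⟨ ⊛-distrib-⊕ k (μ ⊛ f i) (lincomb f cs) ⟨
  k ⊛ ((μ ⊛ f i) ⊕ lincomb f cs)                     ∎
  where open ≡-Reasoning

lincomb-cong : ∀ {f g : I → Vec ℚ n} {cs} → All (λ p → f (proj₂ p) ≡ g (proj₂ p)) cs →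
  lincomb f cs ≡ lincomb g cs
lincomb-cong []                         = refl
lincomb-cong {cs = (μ , i) ∷ _} (e ∷ es) = cong₂ (λ x y → (μ ⊛ x) ⊕ y) e (lincomb-cong es)

·-lincomb : ∀ (c : Vec ℚ n) (f : I → Vec ℚ n) cs →
  c · lincomb f cs ≡ ∑ (λ p → proj₁ p * (c · f (proj₂ p))) cs
·-lincomb c f []             = ·-0ᵛ c
·-lincomb c f ((μ , i) ∷ cs) =
  trans (·-⊕ʳ c (μ ⊛ f i) (lincomb f cs)) (cong₂ _+_ (·-⊛ʳ c μ (f i)) (·-lincomb c f cs))

lincomb-⊖ : ∀ (f g : I → Vec ℚ n) cs → lincomb (λ i → f i ⊖ g i) cs ≡ lincomb f cs ⊖ lincomb g cs
lincomb-⊖ f g []             = base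
  where
  base : ∀ {n} → 0ᵛ {n} ≡ 0ᵛ ⊖ 0ᵛ
  base {zero}  = refl
  base {suc n} = cong (0ℚ ∷_) base
lincomb-⊖ f g ((μ , i) ∷ cs) = trans (cong ((μ ⊛ (f i ⊖ g i)) ⊕_) (lincomb-⊖ f g cs)) (step μ (f i) (g i) _ _)
  where
  step : ∀ {n} μ (x y X Y : Vec ℚ n) → (μ ⊛ (x ⊖ y)) ⊕ (X ⊖ Y) ≡ ((μ ⊛ x) ⊕ X) ⊖ ((μ ⊛ y) ⊕ Y)
  step μ []      []      []      []      = refl
  step μ (a ∷ x) (b ∷ y) (A ∷ X) (B ∷ Y) = cong₂ _∷_ (coordinate μ a b A B) (step μ x y X Y)
    where
    coordinate : ∀ μ a b A B → μ * (a + (- 1ℚ) * b) + (A + (- 1ℚ) * B) ≡ μ * a + A + (- 1ℚ) * (μ * b + B)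
    coordinate = solve-∀ ℚ-ring

lincomb-pair : ∀ (α β : I → ℚ) (x y : Vec ℚ n) cs →
  lincomb (λ i → (α i ⊛ x) ⊕ (β i ⊛ y)) cs
    ≡ (∑ (λ p → proj₁ p * α (proj₂ p)) cs ⊛ x) ⊕ (∑ (λ p → proj₁ p * β (proj₂ p)) cs ⊛ y)
lincomb-pair α β x y []             = base x y
  where
  base : ∀ {n} (x y : Vec ℚ n) → 0ᵛ ≡ (0ℚ ⊛ x) ⊕ (0ℚ ⊛ y)
  base []      []      = refl
  base (a ∷ x) (b ∷ y) = cong₂ _∷_ (coordinate a b) (base x y)
    where
    coordinate : ∀ a b → 0ℚ ≡ 0ℚ * a + 0ℚ * b
    coordinate = solve-∀ ℚ-ring
lincomb-pair α β x y ((μ , i) ∷ cs) =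
  trans (cong ((μ ⊛ ((α i ⊛ x) ⊕ (β i ⊛ y))) ⊕_) (lincomb-pair α β x y cs)) (step μ (α i) (β i) _ _ x y)
  where
  step : ∀ {n} μ a b A B (x y : Vec ℚ n) →
    (μ ⊛ ((a ⊛ x) ⊕ (b ⊛ y))) ⊕ ((A ⊛ x) ⊕ (B ⊛ y)) ≡ ((μ * a + A) ⊛ x) ⊕ ((μ * b + B) ⊛ y)
  step μ a b A B []       []       = refl
  step μ a b A B (x₀ ∷ x) (y₀ ∷ y) = cong₂ _∷_ (coordinate μ a b A B x₀ y₀) (step μ a b A B x y)
    where
    coordinate : ∀ μ a b A B x y → μ * (a * x + b * y) + (A * x + B * y) ≡ (μ * a + A) * x + (μ * b + B) * y
    coordinate = solve-∀ ℚ-ring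

lincomb-∷ : ∀ (f : I → Vec ℚ (suc n)) cs →
  lincomb f cs ≡ ∑ (λ p → proj₁ p * head (f (proj₂ p))) cs ∷ lincomb (tail ∘ f) cs
lincomb-∷ f []             = refl
lincomb-∷ f ((μ , i) ∷ cs) = trans (cong ((μ ⊛ f i) ⊕_) (lincomb-∷ f cs)) (split μ (f i))
  where
  split : ∀ {n} μ (x : Vec ℚ (suc n)) {h t} → (μ ⊛ x) ⊕ (h ∷ t) ≡ (μ * head x + h) ∷ ((μ ⊛ tail x) ⊕ t)
  split μ (_ ∷ _) = refl

lincomb-0∷ : ∀ (g : I → Vec ℚ n) cs → lincomb (λ j → 0ℚ ∷ g j) cs ≡ 0ℚ ∷ lincomb g cs
lincomb-0∷ g []             = refl
lincomb-0∷ g ((μ , j) ∷ cs) =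
  trans (cong ((μ ⊛ (0ℚ ∷ g j)) ⊕_) (lincomb-0∷ g cs))
        (cong (_∷ ((μ ⊛ g j) ⊕ lincomb g cs)) (trans (+-identityʳ (μ * 0ℚ)) (*-zeroʳ μ)))

expand : ∀ {J : Set} → (J → List (ℚ × I)) → List (ℚ × J) → List (ℚ × I)
expand g = concat ∘ map (λ p → map (map₁ (proj₁ p *_)) (g (proj₂ p)))

lincomb-expand : ∀ {J : Set} (f : I → Vec ℚ n) (g : J → List (ℚ × I)) cs →
  lincomb f (expand g cs) ≡ lincomb (lincomb f ∘ g) cs
lincomb-expand f g []             = refl
lincomb-expand f g ((μ , j) ∷ cs) = begin
  lincomb f (map (map₁ (μ *_)) (g j) ++ expand g cs)
    ≡⟨ lincomb-++ f (map (map₁ (μ *_)) (g j)) (expand g cs) ⟩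
  lincomb f (map (map₁ (μ *_)) (g j)) ⊕ lincomb f (expand g cs)
    ≡⟨ cong₂ _⊕_ (lincomb-scale f μ (g j)) (lincomb-expand f g cs) ⟩
  (μ ⊛ lincomb f (g j)) ⊕ lincomb (lincomb f ∘ g) cs
    ∎
  where open ≡-Reasoning

-- Gordan's alternative

StrictlyNegative : (I → Vec ℚ n) → List I → Set
StrictlyNegative {n = n} f Is = Σ (Vec ℚ n) λ c → All (λ i → c · f i < 0ℚ) Is

NonnegDependent : (I → Vec ℚ n) → List I → Set
NonnegDependent {I = I} f Is = Σ (List (ℚ × I)) λ cs →
    All (λ p → 0ℚ ≤ proj₁ p × proj₂ p ∈ Is) cs
  × Any (λ p → 0ℚ < proj₁ p) cs
  × lincomb f cs ≡ 0ᵛ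

c₀a+t<0-pos : ∀ {a t c₀} → 0ℚ < a → c₀ < - (inv a * t) → c₀ * a + t < 0ℚ
c₀a+t<0-pos {a} {t} {c₀} 0<a c₀<bound =
  p<-q⇒p+q<0 (subst (c₀ * a <_) bound*a≡-t (*-monoˡ-<-pos a {{positive 0<a}} c₀<bound))
  where
  bound*a≡-t : - (inv a * t) * a ≡ - t
  bound*a≡-t = begin
    - (inv a * t) * a   ≡⟨ rearrange a (inv a) t ⟩
    - (t * (a * inv a)) ≡⟨ cong (λ e → - (t * e)) (*-inv (0<p⇒p≢0 0<a)) ⟩
    - (t * 1ℚ)          ≡⟨ cong -_ (*-identityʳ t) ⟩
    - t                 ∎
    where
    open ≡-Reasoning
    rearrange : ∀ a u t → - (u * t) * a ≡ - (t * (a * u))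
    rearrange = solve-∀ ℚ-ring

c₀a+t<0-zero : ∀ {a t c₀} → a ≡ 0ℚ → t < 0ℚ → c₀ * a + t < 0ℚ
c₀a+t<0-zero {t = t} {c₀} refl t<0 = subst (_< 0ℚ) (sym (trans (cong (_+ t) (*-zeroʳ c₀)) (+-identityˡ t))) t<0

c₀a+t<0-neg : ∀ {a t c₀} → a < 0ℚ → inv (- a) * t < c₀ → c₀ * a + t < 0ℚ
c₀a+t<0-neg {a} {t} {c₀} a<0 bound<c₀ =
  subst (λ e → e + t < 0ℚ) (-c₀*-a≡c₀*a c₀ a) (c₀a+t<0-pos (neg-antimono-< a<0) (neg-antimono-< bound<c₀))
  where
  -c₀*-a≡c₀*a : ∀ c₀ a → - c₀ * - a ≡ c₀ * a
  -c₀*-a≡c₀*a = solve-∀ ℚ-ring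

-- One step of Fourier–Motzkin elimination of the first coordinate.
module Elimination {n : ℕ} {I : Set} (f : I → Vec ℚ (suc n)) (Is : List I) where

  a : I → ℚ
  a = head ∘ f

  z : I → Vec ℚ n
  z = tail ∘ f

  Zs Ps Ns : List I
  Zs = filter (λ i → a i ≟ 0ℚ) Is
  Ps = filter (λ i → 0ℚ <? a i) Is
  Ns = filter (λ i → a i <? 0ℚ) Is

  I′ : Set
  I′ = I ⊎ (I × I)

  Is′ : List I′
  Is′ = map inj₁ Zs ++ map inj₂ (cartesianProduct Ps Ns)

  combination : I′ → List (ℚ × I)
  combination (inj₁ i)       = (1ℚ , i) ∷ []
  combination (inj₂ (p , q)) = (inv (a p) , p) ∷ (inv (- a q) , q) ∷ []

  f′ : I′ → Vec ℚ n
  f′ = lincomb z ∘ combination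

  Origin : I′ → Set
  Origin (inj₁ i)       = i ∈ Is × a i ≡ 0ℚ
  Origin (inj₂ (p , q)) = (p ∈ Is × 0ℚ < a p) × (q ∈ Is × a q < 0ℚ)

  origin : ∀ {j} → j ∈ Is′ → Origin j
  origin j∈Is′ with ∈-++⁻ (map inj₁ Zs) j∈Is′
  ... | inj₁ j∈Zs with ∈-map⁻ inj₁ j∈Zs
  ...   | i , i∈Zs , refl = ∈-filter⁻ (λ i → a i ≟ 0ℚ) i∈Zs
  origin j∈Is′ | inj₂ j∈PNs with ∈-map⁻ inj₂ j∈PNs
  ...   | (p , q) , pq∈PNs , refl with ∈-cartesianProduct⁻ Ps Ns pq∈PNs
  ...     | p∈Ps , q∈Ns = ∈-filter⁻ (λ i → 0ℚ <? a i) p∈Ps , ∈-filter⁻ (λ i → a i <? 0ℚ) q∈Ns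

  combination-valid : ∀ j → Origin j → All (λ p → 0ℚ ≤ proj₁ p × proj₂ p ∈ Is) (combination j)
  combination-valid (inj₁ i)       (i∈Is , _) = (<⇒≤ 0<1 , i∈Is) ∷ []
  combination-valid (inj₂ (p , q)) ((p∈Is , 0<ap) , (q∈Is , aq<0)) =
    (<⇒≤ (inv-pos 0<ap) , p∈Is) ∷ (<⇒≤ (inv-pos (neg-antimono-< aq<0)) , q∈Is) ∷ []

  combination-pos : ∀ j → Origin j → Any (λ p → 0ℚ < proj₁ p) (combination j)
  combination-pos (inj₁ i)       _               = here 0<1
  combination-pos (inj₂ (p , q)) ((_ , 0<ap) , _) = here (inv-pos 0<ap)

  combination-cancels : ∀ j → Origin j → lincomb f (combination j) ≡ 0ℚ ∷ f′ j
  combination-cancels j o = trans (lincomb-∷ f (combination j)) (cong (_∷ f′ j) (cancels j o))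
    where
    cancels : ∀ j → Origin j → ∑ (λ p → proj₁ p * a (proj₂ p)) (combination j) ≡ 0ℚ
    cancels (inj₁ i) (_ , ai≡0) rewrite ai≡0 = refl
    cancels (inj₂ (p , q)) ((_ , 0<ap) , (_ , aq<0)) = begin
      inv (a p) * a p + (inv (- a q) * a q + 0ℚ)
        ≡⟨ rearrange (a p) (a q) (inv (a p)) (inv (- a q)) ⟩
      a p * inv (a p) - (- a q) * inv (- a q)
        ≡⟨ cong₂ _-_ (*-inv (0<p⇒p≢0 0<ap)) (*-inv (0<p⇒p≢0 (neg-antimono-< aq<0))) ⟩
      1ℚ - 1ℚ
        ∎
      where
      open ≡-Reasoning
      rearrange : ∀ x y u v → u * x + (v * y + 0ℚ) ≡ x * u - (- y) * v
      rearrange = solve-∀ ℚ-ring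

  negative-lift : StrictlyNegative f′ Is′ → StrictlyNegative f Is
  negative-lift (c , neg′) = c₀ ∷ c , All.tabulate neg
    where
    lo hi : I → ℚ
    lo q = inv (- a q) * (c · z q)
    hi p = - (inv (a p) * (c · z p))

    lo<hi : ∀ {p q} → p ∈ Ps → q ∈ Ns → lo q < hi p
    lo<hi {p} {q} p∈Ps q∈Ns = p+q<0⇒q<-p (subst (_< 0ℚ) value
      (All.lookup neg′ (∈-++⁺ʳ (map inj₁ Zs) (∈-map⁺ inj₂ (∈-cartesianProduct⁺ p∈Ps q∈Ns)))))
      where
      value : c · f′ (inj₂ (p , q)) ≡ inv (a p) * (c · z p) + inv (- a q) * (c · z q)
      value = trans (·-lincomb c z (combination (inj₂ (p , q))))
                    (cong (inv (a p) * (c · z p) +_) (+-identityʳ _))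

    separation : ∃[ x ] All (_< x) (map lo Ns) × All (x <_) (map hi Ps)
    separation = separating-point (map lo Ns) (map hi Ps)
      (All.map⁺ (All.tabulate λ q∈Ns → All.map⁺ (All.tabulate λ p∈Ps → lo<hi p∈Ps q∈Ns)))

    c₀ : ℚ
    c₀ = proj₁ separation

    neg : ∀ {i} → i ∈ Is → (c₀ ∷ c) · f i < 0ℚ
    neg {i} i∈Is = subst (_< 0ℚ) (sym (·-∷ c₀ c (f i))) (by-sign (<-cmp (a i) 0ℚ))
      where
      by-sign : Tri (a i < 0ℚ) (a i ≡ 0ℚ) (0ℚ < a i) → c₀ * a i + c · z i < 0ℚ
      by-sign (tri< ai<0 _ _) = c₀a+t<0-neg ai<0
        (All.lookup (All.map⁻ (proj₁ (proj₂ separation))) (∈-filter⁺ (λ i → a i <? 0ℚ) i∈Is ai<0))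
      by-sign (tri> _ _ 0<ai) = c₀a+t<0-pos 0<ai
        (All.lookup (All.map⁻ (proj₂ (proj₂ separation))) (∈-filter⁺ (λ i → 0ℚ <? a i) i∈Is 0<ai))
      by-sign (tri≈ _ ai≡0 _) = c₀a+t<0-zero {c₀ = c₀} ai≡0 (subst (_< 0ℚ) value
        (All.lookup neg′ (∈-++⁺ˡ (∈-map⁺ inj₁ (∈-filter⁺ (λ i → a i ≟ 0ℚ) i∈Is ai≡0)))))
        where
        value : c · f′ (inj₁ i) ≡ c · z i
        value = trans (·-lincomb c z (combination (inj₁ i))) (trans (+-identityʳ _) (*-identityˡ _))

  dependence-lift : NonnegDependent f′ Is′ → NonnegDependent f Is
  dependence-lift (cs , valid , pos , sum≡0) = expand combination cs , valid↑ , pos↑ , sum↑≡0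
    where
    valid↑ : All (λ p → 0ℚ ≤ proj₁ p × proj₂ p ∈ Is) (expand combination cs)
    valid↑ = All.concat⁺ (All.map⁺ (All.map
      (λ (0≤μ , j∈Is′) → All.map⁺ (All.map (map₁ (*-nonNeg 0≤μ)) (combination-valid _ (origin j∈Is′))))
      valid))

    pos↑ : Any (λ p → 0ℚ < proj₁ p) (expand combination cs)
    pos↑ with find pos
    ... | (μ , j) , p∈cs , 0<μ = Any.concat⁺ (Any.map⁺ (lose p∈cs
      (Any.map⁺ (Any.map (*-pos 0<μ) (combination-pos j (origin (proj₂ (All.lookup valid p∈cs))))))))

    sum↑≡0 : lincomb f (expand combination cs) ≡ 0ᵛ
    sum↑≡0 = begin
      lincomb f (expand combination cs)
        ≡⟨ lincomb-expand f combination cs ⟩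
      lincomb (lincomb f ∘ combination) cs
        ≡⟨ lincomb-cong (All.map (λ (_ , j∈Is′) → combination-cancels _ (origin j∈Is′)) valid) ⟩
      lincomb (λ j → 0ℚ ∷ f′ j) cs
        ≡⟨ lincomb-0∷ f′ cs ⟩
      0ℚ ∷ lincomb f′ cs
        ≡⟨ cong (0ℚ ∷_) sum≡0 ⟩
      0ᵛ
        ∎
      where open ≡-Reasoning

gordan : ∀ n {I : Set} (f : I → Vec ℚ n) Is → StrictlyNegative f Is ⊎ NonnegDependent f Is
gordan zero    f []      = inj₁ ([] , [])
gordan zero    f (i ∷ _) = inj₂ ((1ℚ , i) ∷ [] , (<⇒≤ 0<1 , here refl) ∷ [] , here 0<1 , vec₀ _)
  where
  vec₀ : (x : Vec ℚ 0) → x ≡ []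
  vec₀ [] = refl
gordan (suc n) f Is with gordan n (Elimination.f′ f Is) (Elimination.Is′ f Is)
... | inj₁ negative  = inj₁ (Elimination.negative-lift f Is negative)
... | inj₂ dependent = inj₂ (Elimination.dependence-lift f Is dependent)

-- Points of the cube and the functionals ½(v − w) and ½(v + w)

_≟ᶜ_ : ∀ {d} (u v : Cube d) → Dec (u ≡ v)
_≟ᶜ_ = ≡-dec Bool._≟_

InQ*? : ∀ {d} (v w : Cube d) → Decidable (InQ* v w)
InQ*? v w u = all? (λ i → (lookup v i Bool.≟ lookup w i) →-dec (lookup u i Bool.≟ lookup v i))
         ×-dec ¬? (u ≟ᶜ v) ×-dec ¬? (u ≟ᶜ w)

half-diff half-sum : Bool → Bool → ℚ
half-diff a b = ½ * (sgn a - sgn b)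
half-sum  a b = ½ * (sgn a + sgn b)

G H : ∀ {d} → Cube d → Cube d → Vec ℚ d
G = zipWith half-diff
H = zipWith half-sum

G-antisym : ∀ {d} (v w : Cube d) → G v w · embed w ≡ - (G v w · embed v)
G-antisym []      []      = refl
G-antisym (a ∷ v) (b ∷ w) =
  trans (cong₂ _+_ (coordinate a b) (G-antisym v w)) (sym (neg-distrib-+ (half-diff a b * sgn a) (G v w · embed v)))
  where
  coordinate : ∀ a b → half-diff a b * sgn b ≡ - (half-diff a b * sgn a)
  coordinate true  true  = refl
  coordinate true  false = refl
  coordinate false true  = refl
  coordinate false false = refl

G-max : ∀ {d} (v w u : Cube d) → G v w · embed u ≤ G v w · embed v
G-max []      []      []      = ≤-refl
G-max (a ∷ v) (b ∷ w) (x ∷ u) = +-mono-≤ (coordinate a b x) (G-max v w u)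
  where
  coordinate : ∀ a b x → half-diff a b * sgn x ≤ half-diff a b * sgn a
  coordinate true  true  true  = ≤ᵇ⇒≤ _
  coordinate true  true  false = ≤ᵇ⇒≤ _
  coordinate true  false true  = ≤ᵇ⇒≤ _
  coordinate true  false false = ≤ᵇ⇒≤ _
  coordinate false true  true  = ≤ᵇ⇒≤ _
  coordinate false true  false = ≤ᵇ⇒≤ _
  coordinate false false true  = ≤ᵇ⇒≤ _
  coordinate false false false = ≤ᵇ⇒≤ _

G-pos : ∀ {d} (v w : Cube d) → v ≢ w → 0ℚ < G v w · embed v
G-pos []      []      v≢w = ⊥-elim (v≢w refl)
G-pos (a ∷ v) (b ∷ w) v≢w with a Bool.≟ b
... | yes refl = +-mono-≤-< (nonNeg a) (G-pos v w (v≢w ∘ cong (a ∷_)))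
  where
  nonNeg : ∀ a → 0ℚ ≤ half-diff a a * sgn a
  nonNeg true  = ≤ᵇ⇒≤ _
  nonNeg false = ≤ᵇ⇒≤ _
... | no a≢b = +-mono-<-≤ (pos a b a≢b) (G-nonNeg v w)
  where
  pos : ∀ a b → a ≢ b → 0ℚ < half-diff a b * sgn a
  pos true  true  a≢b = ⊥-elim (a≢b refl)
  pos true  false _   = 0<1
  pos false true  _   = 0<1
  pos false false a≢b = ⊥-elim (a≢b refl)
  G-nonNeg : ∀ {d} (v w : Cube d) → 0ℚ ≤ G v w · embed v
  G-nonNeg []      []      = ≤-refl
  G-nonNeg (a ∷ v) (b ∷ w) = +-mono-≤ (coordinate a b) (G-nonNeg v w)
    where
    coordinate : ∀ a b → 0ℚ ≤ half-diff a b * sgn a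
    coordinate true  true  = ≤ᵇ⇒≤ _
    coordinate true  false = ≤ᵇ⇒≤ _
    coordinate false true  = ≤ᵇ⇒≤ _
    coordinate false false = ≤ᵇ⇒≤ _

H-sym : ∀ {d} (v w : Cube d) → H v w · embed w ≡ H v w · embed v
H-sym []      []      = refl
H-sym (a ∷ v) (b ∷ w) = cong₂ _+_ (coordinate a b) (H-sym v w)
  where
  coordinate : ∀ a b → half-sum a b * sgn b ≡ half-sum a b * sgn a
  coordinate true  true  = refl
  coordinate true  false = refl
  coordinate false true  = refl
  coordinate false false = refl

half-sum-gap : ∀ a b x →
    ((a ≡ b → x ≡ a) × half-sum a b * sgn x ≡ half-sum a b * sgn a)
  ⊎ (half-sum a b * sgn x + 1ℚ ≤ half-sum a b * sgn a)
half-sum-gap true  true  true  = inj₁ ((λ _ → refl) , refl)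
half-sum-gap true  true  false = inj₂ (≤ᵇ⇒≤ _)
half-sum-gap true  false true  = inj₁ ((λ ()) , refl)
half-sum-gap true  false false = inj₁ ((λ ()) , refl)
half-sum-gap false true  true  = inj₁ ((λ ()) , refl)
half-sum-gap false true  false = inj₁ ((λ ()) , refl)
half-sum-gap false false true  = inj₂ (≤ᵇ⇒≤ _)
half-sum-gap false false false = inj₁ ((λ _ → refl) , refl)

H-gap : ∀ {d} (v w u : Cube d) →
  (InQ v w u × H v w · embed u ≡ H v w · embed v) ⊎ (H v w · embed u + 1ℚ ≤ H v w · embed v)
H-gap []      []      []      = inj₁ ((λ ()) , refl)
H-gap (a ∷ v) (b ∷ w) (x ∷ u) with half-sum-gap a b x | H-gap v w u
... | inj₁ (agree , eq₀) | inj₁ (inQ , eq) = inj₁ ((λ { zero → agree ; (suc i) → inQ i }) , cong₂ _+_ eq₀ eq)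
... | inj₁ (_ , eq₀)     | inj₂ gap        =
  inj₂ (subst (_≤ _) (sym (+-assoc (half-sum a b * sgn x) (H v w · embed u) 1ℚ)) (+-mono-≤ (≤-reflexive eq₀) gap))
... | inj₂ gap₀          | rest            =
  inj₂ (subst (_≤ _) (swap (half-sum a b * sgn x) (H v w · embed u)) (+-mono-≤ gap₀ (weaken rest)))
  where
  swap : ∀ p q → p + 1ℚ + q ≡ p + q + 1ℚ
  swap = solve-∀ ℚ-ring
  weaken : ∀ {P : Set} {p q} → (P × p ≡ q) ⊎ (p + 1ℚ ≤ q) → p ≤ q
  weaken (inj₁ (_ , p≡q)) = ≤-reflexive p≡q
  weaken {p = p} (inj₂ gap) = ≤-trans (≤-reflexive (sym (+-identityʳ p))) (≤-trans (+-monoʳ-≤ p (<⇒≤ 0<1)) gap)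

-- From a separating functional to a supporting hyperplane

equalize : ∀ {d} (v w : Cube d) → v ≢ w → (c : Vec ℚ d) → c · embed v ≤ c · embed w →
  Σ (Vec ℚ d) λ c′ → c′ · embed w ≡ c′ · embed v
                   × (∀ u → c · embed u < c · embed v → c′ · embed u < c′ · embed v)
equalize v w v≢w c cv≤cw = c′ , c′w≡c′v , below
  where
  K cv cw : ℚ
  K  = G v w · embed v
  cv = c · embed v
  cw = c · embed w

  c′ : Vec ℚ _
  c′ = ((K + K) ⊛ c) ⊕ ((cw - cv) ⊛ G v w)

  value : ∀ x → c′ · x ≡ (K + K) * (c · x) + (cw - cv) * (G v w · x)
  value x = trans (·-⊕ˡ ((K + K) ⊛ c) ((cw - cv) ⊛ G v w) x)
                  (cong₂ _+_ (·-⊛ˡ (K + K) c x) (·-⊛ˡ (cw - cv) (G v w) x))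

  c′w≡c′v : c′ · embed w ≡ c′ · embed v
  c′w≡c′v = begin
    c′ · embed w                                   ≡⟨ value (embed w) ⟩
    (K + K) * cw + (cw - cv) * (G v w · embed w)   ≡⟨ cong (λ e → (K + K) * cw + (cw - cv) * e) (G-antisym v w) ⟩
    (K + K) * cw + (cw - cv) * (- K)               ≡⟨ balance K cv cw ⟩
    (K + K) * cv + (cw - cv) * K                   ≡⟨ value (embed v) ⟨
    c′ · embed v                                   ∎
    where
    open ≡-Reasoning
    balance : ∀ K cv cw → (K + K) * cw + (cw - cv) * (- K) ≡ (K + K) * cv + (cw - cv) * K
    balance = solve-∀ ℚ-ring

  below : ∀ u → c · embed u < cv → c′ · embed u < c′ · embed v
  below u cu<cv = 0<q-p⇒p<q (subst (0ℚ <_) (sym gap)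
    (+-mono-<-≤ (*-pos (+-mono-< 0<K 0<K) (p<q⇒0<q-p cu<cv))
                (*-nonNeg (p≤q⇒0≤q-p cv≤cw) (p≤q⇒0≤q-p (G-max v w u)))))
    where
    0<K : 0ℚ < K
    0<K = G-pos v w v≢w
    gap : c′ · embed v - c′ · embed u ≡ (K + K) * (cv - c · embed u) + (cw - cv) * (K - G v w · embed u)
    gap = trans (cong₂ _-_ (value (embed v)) (value (embed u))) (rearrange K cv cw (c · embed u) (G v w · embed u))
      where
      rearrange : ∀ K cv cw cu Gu →
        (K + K) * cv + (cw - cv) * K - ((K + K) * cu + (cw - cv) * Gu) ≡ (K + K) * (cv - cu) + (cw - cv) * (K - Gu)
      rearrange = solve-∀ ℚ-ring

equalize-either : ∀ {d} (v w : Cube d) → v ≢ w → (c : Vec ℚ d) →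
  Σ (Vec ℚ d) λ c′ → c′ · embed w ≡ c′ · embed v
                   × (∀ u → c · embed u < c · embed v → c · embed u < c · embed w → c′ · embed u < c′ · embed v)
equalize-either v w v≢w c with ≤-total (c · embed v) (c · embed w)
... | inj₁ cv≤cw = let c′ , c′w≡c′v , below = equalize v w v≢w c cv≤cw in
  c′ , c′w≡c′v , λ u cu<cv _ → below u cu<cv
... | inj₂ cw≤cv = let c′ , c′v≡c′w , below = equalize w v (v≢w ∘ sym) c cw≤cv in
  c′ , sym c′v≡c′w , λ u _ cu<cw → subst (c′ · embed u <_) (sym c′v≡c′w) (below u cu<cw)

penalize : ∀ {d} (S : List (Cube d)) (v w : Cube d) (c : Vec ℚ d) → c · embed w ≡ c · embed v →
  (∀ u → u ∈ S → InQ* v w u → c · embed u < c · embed v) →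
  Σ (Vec ℚ d) λ c′ → c′ · embed w ≡ c′ · embed v
                   × (∀ u → u ∈ S → u ≢ v → u ≢ w → c′ · embed u < c′ · embed v)
penalize S v w c cw≡cv below = c′ , c′w≡c′v , below′
  where
  excess : Cube _ → ℚ
  excess u = c · embed u - c · embed v

  weight : ℚ
  weight = max 0ℚ (map excess S) + 1ℚ

  excess<weight : ∀ {u} → u ∈ S → excess u < weight
  excess<weight u∈S = ≤-<-trans (All.lookup (xs≤max 0ℚ (map excess S)) (∈-map⁺ excess u∈S))
                                (p<p+1 (max 0ℚ (map excess S)))

  0<weight : 0ℚ < weight
  0<weight = ≤-<-trans (⊥≤max 0ℚ (map excess S)) (p<p+1 (max 0ℚ (map excess S)))

  c′ : Vec ℚ _
  c′ = c ⊕ (weight ⊛ H v w)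

  value : ∀ x → c′ · x ≡ c · x + weight * (H v w · x)
  value x = trans (·-⊕ˡ c (weight ⊛ H v w) x) (cong (c · x +_) (·-⊛ˡ weight (H v w) x))

  c′w≡c′v : c′ · embed w ≡ c′ · embed v
  c′w≡c′v = trans (value (embed w))
    (trans (cong₂ (λ p q → p + weight * q) cw≡cv (H-sym v w)) (sym (value (embed v))))

  below′ : ∀ u → u ∈ S → u ≢ v → u ≢ w → c′ · embed u < c′ · embed v
  below′ u u∈S u≢v u≢w with H-gap v w u
  ... | inj₁ (inQ , Hu≡Hv) = subst₂ _<_ (sym (value (embed u))) (sym (value (embed v)))
    (subst (λ e → c · embed u + weight * e < c · embed v + weight * (H v w · embed v)) (sym Hu≡Hv)
      (+-monoˡ-< (weight * (H v w · embed v)) (below u u∈S (inQ , u≢v , u≢w))))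
  ... | inj₂ gap = 0<q-p⇒p<q (subst (0ℚ <_) (sym difference)
    (+-mono-<-≤ (p<q⇒0<q-p (excess<weight u∈S)) (*-nonNeg (<⇒≤ 0<weight) (p≤q⇒0≤q-p gap))))
    where
    difference : c′ · embed v - c′ · embed u
               ≡ (weight - excess u) + weight * (H v w · embed v - (H v w · embed u + 1ℚ))
    difference = trans (cong₂ _-_ (value (embed v)) (value (embed u)))
      (rearrange (c · embed v) (c · embed u) weight (H v w · embed v) (H v w · embed u))
      where
      rearrange : ∀ cv cu λ′ Hv Hu →
        cv + λ′ * Hv - (cu + λ′ * Hu) ≡ (λ′ - (cu - cv)) + λ′ * (Hv - (Hu + 1ℚ))
      rearrange = solve-∀ ℚ-ring

edge-of-functional : ∀ {d} (S : List (Cube d)) (v w : Cube d) (c : Vec ℚ d) → c · embed w ≡ c · embed v →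
  (∀ u → u ∈ S → u ≢ v → u ≢ w → c · embed u < c · embed v) → IsEdge S v w
edge-of-functional S v w c cw≡cv below = c , c · embed v , refl , cw≡cv , valid , tight
  where
  classify : ∀ u → u ∈ S → u ≡ v ⊎ u ≡ w ⊎ c · embed u < c · embed v
  classify u u∈S with u ≟ᶜ v | u ≟ᶜ w
  ... | yes u≡v | _       = inj₁ u≡v
  ... | no _    | yes u≡w = inj₂ (inj₁ u≡w)
  ... | no u≢v  | no u≢w  = inj₂ (inj₂ (below u u∈S u≢v u≢w))

  valid : ∀ u → u ∈ S → c · embed u ≤ c · embed v
  valid u u∈S with classify u u∈S
  ... | inj₁ refl         = ≤-refl
  ... | inj₂ (inj₁ refl)  = ≤-reflexive cw≡cv
  ... | inj₂ (inj₂ cu<cv) = <⇒≤ cu<cv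

  tight : ∀ u → u ∈ S → c · embed u ≡ c · embed v → u ≡ v ⊎ u ≡ w
  tight u u∈S cu≡cv with classify u u∈S
  ... | inj₁ u≡v          = inj₁ u≡v
  ... | inj₂ (inj₁ u≡w)   = inj₂ u≡w
  ... | inj₂ (inj₂ cu<cv) = ⊥-elim (<⇒≢ cu<cv cu≡cv)

edge-from-separator : ∀ {d} (S : List (Cube d)) (v w : Cube d) → v ≢ w → (c : Vec ℚ d) →
  (∀ u → u ∈ S → InQ* v w u → c · embed u < c · embed v × c · embed u < c · embed w) → IsEdge S v w
edge-from-separator S v w v≢w c separates =
  let c₁ , c₁w≡c₁v , below₁ = equalize-either v w v≢w c
      c₂ , c₂w≡c₂v , below₂ = penalize S v w c₁ c₁w≡c₁v
                                (λ u u∈S inQ* → let cu<cv , cu<cw = separates u u∈S inQ* in below₁ u cu<cv cu<cw)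
  in  edge-of-functional S v w c₂ c₂w≡c₂v below₂

segment : ∀ {d} → Cube d → Cube d → ℚ → Vec ℚ d
segment v w t = (t ⊛ embed v) ⊕ ((1ℚ - t) ⊛ embed w)

·-segment : ∀ {d} (c : Vec ℚ d) (v w : Cube d) t →
  c · segment v w t ≡ t * (c · embed v) + (1ℚ - t) * (c · embed w)
·-segment c v w t = trans (·-⊕ʳ c (t ⊛ embed v) ((1ℚ - t) ⊛ embed w))
                          (cong₂ _+_ (·-⊛ʳ c t (embed v)) (·-⊛ʳ c (1ℚ - t) (embed w)))

module _ {d : ℕ} (S : List (Cube d)) (v w : Cube d) where

  edge⇒avoids : IsEdge S v w → SegmentAvoids S v w
  edge⇒avoids (c , b , cv≡b , cw≡b , c≤b , c≡b⇒) (t , _ , _ , cs , valid , ∑≡1 , lincomb≡) =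
    <-irrefl on-line (begin-strict
      c · segment v w t                             ≡⟨ cong (c ·_) lincomb≡ ⟨
      c · lincomb embed cs                          ≡⟨ ·-lincomb c embed cs ⟩
      ∑ (λ p → proj₁ p * (c · embed (proj₂ p))) cs  <⟨ ∑-weighted-< (All.map (map₂ below) valid)
                                                                    (subst (0ℚ <_) (sym ∑≡1) 0<1) ⟩
      ∑ proj₁ cs * b                                ≡⟨ cong (_* b) ∑≡1 ⟩
      1ℚ * b                                        ≡⟨ *-identityˡ b ⟩
      b                                             ∎)
    where
    open ≤-Reasoning

    below : ∀ {u} → u ∈ S × InQ* v w u → c · embed u < b
    below (u∈S , _ , u≢v , u≢w) = ≤∧≢⇒< (c≤b _ u∈S) ([ u≢v , u≢w ]′ ∘ c≡b⇒ _ u∈S)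

    on-line : c · segment v w t ≡ b
    on-line = trans (·-segment c v w t) (trans (cong₂ (λ p q → t * p + (1ℚ - t) * q) cv≡b cw≡b) (affine t b))
      where
      affine : ∀ t b → t * b + (1ℚ - t) * b ≡ b
      affine = solve-∀ ℚ-ring

  Q*-points : List (Cube d)
  Q*-points = filter (InQ*? v w) S

  -- (1 , u) stands for u − v and (0 , u) for u − w.
  targets : List (ℚ × Cube d)
  targets = map (1ℚ ,_) Q*-points ++ map (0ℚ ,_) Q*-points

  offset : ℚ × Cube d → Vec ℚ d
  offset p = embed (proj₂ p) ⊖ segment v w (proj₁ p)

  target-info : ∀ {s u} → (s , u) ∈ targets → (0ℚ ≤ s × 0ℚ ≤ 1ℚ - s) × u ∈ S × InQ* v w u
  target-info s,u∈ with ∈-++⁻ (map (1ℚ ,_) Q*-points) s,u∈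
  ... | inj₁ s,u∈₁ with ∈-map⁻ (1ℚ ,_) s,u∈₁
  ...   | _ , u∈Q* , refl = (≤ᵇ⇒≤ _ , ≤ᵇ⇒≤ _) , ∈-filter⁻ (InQ*? v w) u∈Q*
  target-info s,u∈ | inj₂ s,u∈₀ with ∈-map⁻ (0ℚ ,_) s,u∈₀
  ...   | _ , u∈Q* , refl = (≤ᵇ⇒≤ _ , ≤ᵇ⇒≤ _) , ∈-filter⁻ (InQ*? v w) u∈Q*

  separator : StrictlyNegative offset targets →
    Σ (Vec ℚ d) λ c → ∀ u → u ∈ S → InQ* v w u → c · embed u < c · embed v × c · embed u < c · embed w
  separator (c , neg) = c , λ u u∈S inQ* →
    let u∈Q* = ∈-filter⁺ (InQ*? v w) u∈S inQ* in
      subst (c · embed u <_) at-v (toward (∈-++⁺ˡ (∈-map⁺ (1ℚ ,_) u∈Q*)))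
    , subst (c · embed u <_) at-w (toward (∈-++⁺ʳ (map (1ℚ ,_) Q*-points) (∈-map⁺ (0ℚ ,_) u∈Q*)))
    where
    toward : ∀ {s u} → (s , u) ∈ targets → c · embed u < c · segment v w s
    toward s,u∈ = p-q<0⇒p<q (subst (_< 0ℚ) (·-⊖ʳ c _ _) (All.lookup neg s,u∈))

    at-v : c · segment v w 1ℚ ≡ c · embed v
    at-v = trans (·-segment c v w 1ℚ) (end-v (c · embed v) (c · embed w))
      where
      end-v : ∀ x y → 1ℚ * x + (1ℚ - 1ℚ) * y ≡ x
      end-v = solve-∀ ℚ-ring

    at-w : c · segment v w 0ℚ ≡ c · embed w
    at-w = trans (·-segment c v w 0ℚ) (end-w (c · embed v) (c · embed w))
      where
      end-w : ∀ x y → 0ℚ * x + (1ℚ - 0ℚ) * y ≡ y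
      end-w = solve-∀ ℚ-ring

  segment-point : NonnegDependent offset targets →
    Σ ℚ λ t → 0ℚ ≤ t × t ≤ 1ℚ × InConv (λ u → u ∈ S × InQ* v w u) (segment v w t)
  segment-point (cs , valid , pos , sum≡0) = t , 0≤t , t≤1 , map (map₂ proj₂) cs₁ , valid₂ , weights₂ , point
    where
    0<∑ : 0ℚ < ∑ proj₁ cs
    0<∑ = ∑-pos (All.map proj₁ valid) pos

    k : ℚ
    k = inv (∑ proj₁ cs)

    cs₁ : List (ℚ × (ℚ × Cube d))
    cs₁ = map (map₁ (k *_)) cs

    valid₁ : All (λ p → 0ℚ ≤ proj₁ p × (0ℚ ≤ proj₁ (proj₂ p) × 0ℚ ≤ 1ℚ - proj₁ (proj₂ p))
                       × proj₂ (proj₂ p) ∈ S × InQ* v w (proj₂ (proj₂ p))) cs₁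
    valid₁ = All.map⁺ (All.map (λ (0≤μ , s,u∈) → *-nonNeg (<⇒≤ (inv-pos 0<∑)) 0≤μ , target-info s,u∈)
                               valid)

    weights₁ : ∑ proj₁ cs₁ ≡ 1ℚ
    weights₁ = trans (foldr-map _ (map₁ (k *_)) 0ℚ cs)
                     (trans (∑-*ˡ proj₁ k cs) (trans (*-comm k _) (*-inv (0<p⇒p≢0 0<∑))))

    share share′ : ℚ × (ℚ × Cube d) → ℚ
    share  p = proj₁ p * proj₁ (proj₂ p)
    share′ p = proj₁ p * (1ℚ - proj₁ (proj₂ p))

    t t′ : ℚ
    t  = ∑ share cs₁
    t′ = ∑ share′ cs₁

    t+t′≡1 : t + t′ ≡ 1ℚ
    t+t′≡1 = trans (sym (∑-+ share share′ cs₁)) (trans (∑-cong (λ p → split (proj₁ p) (proj₁ (proj₂ p))) cs₁) weights₁)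
      where
      split : ∀ μ s → μ * s + μ * (1ℚ - s) ≡ μ
      split = solve-∀ ℚ-ring

    t′≡1-t : t′ ≡ 1ℚ - t
    t′≡1-t = trans (rearrange t t′) (cong (_- t) t+t′≡1)
      where
      rearrange : ∀ t t′ → t′ ≡ t + t′ - t
      rearrange = solve-∀ ℚ-ring

    0≤t : 0ℚ ≤ t
    0≤t = ∑-nonNeg (All.map (λ (0≤μ , (0≤s , _) , _) → *-nonNeg 0≤μ 0≤s) valid₁)

    t≤1 : t ≤ 1ℚ
    t≤1 = 0≤q-p⇒p≤q (subst (0ℚ ≤_) t′≡1-t
      (∑-nonNeg (All.map (λ (0≤μ , (_ , 0≤1-s) , _) → *-nonNeg 0≤μ 0≤1-s) valid₁)))

    valid₂ : All (λ p → 0ℚ ≤ proj₁ p × proj₂ p ∈ S × InQ* v w (proj₂ p)) (map (map₂ proj₂) cs₁)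
    valid₂ = All.map⁺ (All.map (λ (0≤μ , _ , member) → 0≤μ , member) valid₁)

    weights₂ : ∑ proj₁ (map (map₂ proj₂) cs₁) ≡ 1ℚ
    weights₂ = trans (foldr-map _ (map₂ proj₂) 0ℚ cs₁) weights₁

    offsets≡0 : lincomb offset cs₁ ≡ 0ᵛ
    offsets≡0 = trans (lincomb-scale offset k cs) (trans (cong (k ⊛_) sum≡0) (⊛-0ᵛ k))

    point : lincomb embed (map (map₂ proj₂) cs₁) ≡ segment v w t
    point = begin
      lincomb embed (map (map₂ proj₂) cs₁)
        ≡⟨ foldr-map _ (map₂ proj₂) 0ᵛ cs₁ ⟩
      lincomb (embed ∘ proj₂) cs₁
        ≡⟨ ⊖≡0ᵛ⇒≡ _ _ (trans (sym (lincomb-⊖ (embed ∘ proj₂) (segment v w ∘ proj₁) cs₁)) offsets≡0) ⟩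
      lincomb (segment v w ∘ proj₁) cs₁
        ≡⟨ lincomb-pair proj₁ (λ i → 1ℚ - proj₁ i) (embed v) (embed w) cs₁ ⟩
      (t ⊛ embed v) ⊕ (t′ ⊛ embed w)
        ≡⟨ cong (λ e → (t ⊛ embed v) ⊕ (e ⊛ embed w)) t′≡1-t ⟩
      segment v w t
        ∎
      where open ≡-Reasoning

  avoids⇒edge : v ≢ w → SegmentAvoids S v w → IsEdge S v w
  avoids⇒edge v≢w avoids with gordan d offset targets
  ... | inj₁ negative  = let c , separates = separator negative in edge-from-separator S v w v≢w c separates
  ... | inj₂ dependent = ⊥-elim (avoids (segment-point dependent))

lemma1 : (d : ℕ) (S : List (Cube d)) (v w : Cube d) →
    v ∈ S → w ∈ S → v ≢ w →
    (IsEdge S v w → SegmentAvoids S v w) × (SegmentAvoids S v w → IsEdge S v w)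
lemma1 d S v w _ _ v≢w = edge⇒avoids S v w , avoids⇒edge S v w v≢w
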